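{- For each integer $d\ge1$, let $L_d^{\mathrm{idim}}=\{w\in\{0,1\}^*\mid |w|_0=|w|_1=2d,\ \exists x\in\{0011,1100\}\ \forall k\in\{1,\dots,d\}:\ \delta_{k,k}^{2d}(w)=x\}$. Then $L_d^{\mathrm{idim}}$ is $2d$-uniform and $\mathcal{G}_{L_d^{\mathrm{idim}}}$ is exactly the class of comparability graphs of posets of interval dimension at most $d$.
   Context: $|w|_a$ is the number of occurrences of letter $a$ in $w$; a binary word is $k$-uniform if it has exactly $k$ occurrences of $0$ and of $1$. For a $2d$-uniform binary word $w$ and $k\in\{1,\dots,d\}$, $\delta_{k,k}^{2d}(w)$ keeps only the $(2k-1)$-st and $2k$-th occurrences of $0$ and of $1$, deleting all other letters. For a word $w$ and distinct letters $a,b$, $h_{a,b}(w)$ replaces $a$ by $0$, $b$ by $1$ and deletes other letters. For $L\subseteq\{0,1\}^*$ closed under exchanging $0$ and $1$ and a word $w$ with letter set $V$, $G(L,w)$ is the graph on $V$ where distinct $u,v$ are adjacent iff $h_{u,v}(w)\in L$; $\mathcal{G}_L$ is the class of graphs isomorphic to some $G(L,w)$. An interval order is a partial order whose elements $x$ can be assigned closed real intervals $I_x$ such that $x\prec y$ iff $I_x$ lies entirely to the left of $I_y$. The interval dimension of a poset is the smallest number of interval orders whose intersection is the poset. The comparability graph of a poset joins two distinct elements iff they are comparable.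
   Formalization: The closed intervals $I_x$ representing interval orders, and hence interval dimension at most d, have rational endpoints rather than real ones. -}

module Defs where

open import Data.Nat as ℕ using (ℕ; zero; suc; _+_; _*_; _∸_; _≤_)
open import Data.Bool using (Bool; true; false; if_then_else_; _∨_)
open import Data.List using (List; []; _∷_; length; filter)
open import Data.Fin using (Fin)
import Data.Fin.Properties as FinP
open import Data.Product using (Σ; ∃; ∃-syntax; _×_; _,_; proj₁; proj₂)
open import Data.Sum using (_⊎_)
open import Relation.Nullary using (¬_; ⌊_⌋)
open import Relation.Binary.PropositionalEquality using (_≡_; _≢_)
open import Relation.Binary.Structures using (IsStrictPartialOrder)
open import Data.List.Membership.Propositional using (_∈_)
open import Function.Definitions using (Bijective)
open import Function.Bundles using (_⇔_)
open import Data.Rational as ℚ using (ℚ)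

-- Binary words: 0 is represented by false, 1 by true.

BinWord : Set
BinWord = List Bool

count : Bool → BinWord → ℕ
count a []      = 0
count a (b ∷ w) = (if ⌊ a Data.Bool.≟ b ⌋ then 1 else 0) + count a w
  where import Data.Bool

IsUniformWord : ℕ → BinWord → Set
IsUniformWord k w = (count false w ≡ k) × (count true w ≡ k)

IsUniformLang : ℕ → (BinWord → Set) → Set
IsUniformLang k L = ∀ w → L w → IsUniformWord k w

-- δ_{k,k}(w): keep only the (2k-1)-st and 2k-th occurrences of 0 and
-- of 1 and delete all other letters.

-- keep k c : is c (a 1-based occurrence index) equal to 2k-1 or 2k ?
keepOcc : ℕ → ℕ → Bool
keepOcc k c = ⌊ c ℕ.≟ (2 * k ∸ 1) ⌋ ∨ ⌊ c ℕ.≟ (2 * k) ⌋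

-- c0, c1 : numbers of 0s and 1s already read
δgo : ℕ → ℕ → ℕ → BinWord → BinWord
δgo k c0 c1 []           = []
δgo k c0 c1 (false ∷ w) =
  if keepOcc k (suc c0) then false ∷ δgo k (suc c0) c1 w else δgo k (suc c0) c1 w
δgo k c0 c1 (true ∷ w) =
  if keepOcc k (suc c1) then true ∷ δgo k c0 (suc c1) w else δgo k c0 (suc c1) w

δkk : ℕ → BinWord → BinWord
δkk k w = δgo k 0 0 w

w0011 w1100 : BinWord
w0011 = false ∷ false ∷ true ∷ true ∷ []
w1100 = true ∷ true ∷ false ∷ false ∷ []

Lidim : ℕ → BinWord → Set
Lidim d w =
  IsUniformWord (2 * d) w ×
  (∃[ x ] ((x ≡ w0011 ⊎ x ≡ w1100) ×
           (∀ k → 1 ≤ k → k ≤ d → δkk k w ≡ x)))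

hom : ∀ {m} → Fin m → Fin m → List (Fin m) → BinWord
hom a b []      = []
hom a b (c ∷ w) with a FinP.≟ c | b FinP.≟ c
... | Relation.Nullary.yes _ | _ = false ∷ hom a b w
... | Relation.Nullary.no _ | Relation.Nullary.yes _ = true ∷ hom a b w
... | Relation.Nullary.no _ | Relation.Nullary.no _ = hom a b w

UsesAllLetters : ∀ {m} → List (Fin m) → Set
UsesAllLetters {m} w = ∀ (a : Fin m) → a ∈ w

GAdj : (BinWord → Set) → ∀ {m} → List (Fin m) → Fin m → Fin m → Set
GAdj L w u v = (u ≢ v) × L (hom u v w)

InGraphClass : (BinWord → Set) → ∀ {n} → (Fin n → Fin n → Set) → Set
InGraphClass L {n} E =
  ∃[ m ] Σ (List (Fin m)) λ w → UsesAllLetters w ×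
    (Σ (Fin n → Fin m) λ f → Bijective _≡_ _≡_ f ×
       (∀ u v → E u v ⇔ GAdj L w (f u) (f v)))

IntervalRep : ℕ → Set
IntervalRep n = Σ (Fin n → ℚ) λ lo → Σ (Fin n → ℚ) λ hi → ∀ x → lo x ℚ.≤ hi x

IntervalPrec : ∀ {n} → IntervalRep n → Fin n → Fin n → Set
IntervalPrec (lo , hi , _) x y = hi x ℚ.< lo y

IsIntersectionOfIntervalOrders : ∀ {n} → ℕ → (Fin n → Fin n → Set) → Set
IsIntersectionOfIntervalOrders {n} m _≺_ =
  Σ (Fin m → IntervalRep n) λ I →
    ∀ x y → (x ≺ y) ⇔ (∀ i → IntervalPrec (I i) x y)

IntervalDimAtMost : ∀ {n} → ℕ → (Fin n → Fin n → Set) → Set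
IntervalDimAtMost d _≺_ = ∃[ m ] (m ≤ d × IsIntersectionOfIntervalOrders m _≺_)

IsComparabilityGraphOf : ∀ {n} → (Fin n → Fin n → Set) → (Fin n → Fin n → Set) → Set
IsComparabilityGraphOf E _≺_ = ∀ u v → E u v ⇔ ((u ≢ v) × (u ≺ v ⊎ v ≺ u))

IsCompGraphIdimAtMost : ℕ → ∀ {n} → (Fin n → Fin n → Set) → Set₁
IsCompGraphIdimAtMost d {n} E =
  Σ (Fin n → Fin n → Set) λ _≺_ →
    IsStrictPartialOrder _≡_ _≺_ × IntervalDimAtMost d _≺_ × IsComparabilityGraphOf E _≺_

IsSimpleGraph : ∀ {n} → (Fin n → Fin n → Set) → Set
IsSimpleGraph {n} E = (∀ u v → E u v → E v u) × (∀ u → ¬ E u u)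

module Submission where

-- The j-th occurrence of a letter a precedes the j′-th occurrence of b iff some
-- prefix contains at least j letters a and fewer than j′ letters b.  As δ_{k,k}
-- keeps the (2k−1)-st and 2k-th occurrence of each letter, δ_{k,k}(z) = 0011
-- says that the 2k-th 0 of z precedes its (2k−1)-st 1.  Hence, for letters a, b
-- occurring 2d times in w, and I_k(x) the stretch of w from the (2k−1)-st to the
-- 2k-th occurrence of x: h_{a,b}(w) ∈ L_d^idim iff I_k(a) lies left of I_k(b)
-- for every k, or I_k(b) lies left of I_k(a) for every k.  So G(L, w) is the
-- comparability graph of the intersection of the d interval orders I_1, …, I_d
-- (the other letters are isolated, and get an interval meeting all others).
-- Conversely, d interval representations are realised by the concatenation of
-- d blocks, block k writing each letter at the two endpoints of its k-th interval
-- after these have been replaced by integers, no left endpoint equal to a right one.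

open import Defs
open import Data.Nat using (ℕ; zero; suc; _+_; _*_; _∸_; _≤_; _<_; z≤n; s≤s; _≤?_; _<?_)
open import Data.Nat.Properties
open import Data.Bool using (Bool; true; false; not; if_then_else_; _∨_)
import Data.Bool.Properties as BoolP
open import Data.List using (List; []; _∷_; _++_; length; take; drop; replicate; filter; concat; tabulate; allFin; map)
open import Data.List.Relation.Unary.Any using (here; there)
open import Data.List.Membership.Propositional using (_∈_)
open import Data.List.Membership.Propositional.Properties using (∈-allFin)
open import Data.List.Properties
  using (∷-injective; ++-assoc; ++-identityʳ; take++drop≡id; length-take; map-tabulate; length-filter)
open import Data.Fin using (Fin; toℕ; fromℕ<)
import Data.Fin as Fin
import Data.Fin.Properties as FinP
open import Data.Product using (Σ; ∃; ∃₂; ∃-syntax; _×_; _,_; proj₁; proj₂)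
open import Data.Sum using (_⊎_; inj₁; inj₂; [_,_])
open import Data.Sum.Function.Propositional using (_⊎-⇔_)
open import Function using (_∘_; id)
open import Data.Empty using (⊥; ⊥-elim)
open import Function.Bundles using (_⇔_; mk⇔; Equivalence)
import Function.Construct.Composition as Composition
import Function.Construct.Identity as Identity
open import Function.Construct.Symmetry using (⇔-sym)
import Data.Integer as ℤ
import Data.Integer.Properties as ZP
open import Data.Rational as ℚ using (ℚ; mkℚ)
import Data.Rational.Properties as QP
import Data.Nat.Coprimality as Coprime
open import Relation.Binary.Structures using (IsStrictPartialOrder)
open import Relation.Nullary using (¬_; Dec; yes; no; ⌊_⌋; contradiction)
open import Relation.Binary.Definitions using (DecidableEquality)
open import Relation.Unary using (Decidable)
open import Relation.Binary.PropositionalEquality hiding ([_])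
open import Algebra.Properties.CommutativeSemigroup +-commutativeSemigroup using (interchange)

++-prefixes : ∀ {A : Set} (u v p q : List A) → u ++ v ≡ p ++ q →
  (∃ λ s → p ≡ u ++ s × v ≡ s ++ q) ⊎ (∃ λ s → u ≡ p ++ s)
++-prefixes []      v p       q e = inj₁ (p , refl , e)
++-prefixes (x ∷ u) v []      q e = inj₂ (x ∷ u , refl)
++-prefixes (x ∷ u) v (y ∷ p) q e with ∷-injective e
... | refl , e′ with ++-prefixes u v p q e′
...   | inj₁ (s , refl , v≡) = inj₁ (s , refl , v≡)
...   | inj₂ (s , refl)      = inj₂ (s , refl)

module Occurrences {A : Set} (_≟_ : DecidableEquality A) where

  occ : A → List A → ℕ
  occ a []      = 0
  occ a (c ∷ w) = (if ⌊ a ≟ c ⌋ then 1 else 0) + occ a w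

  occ-++ : ∀ a u v → occ a (u ++ v) ≡ occ a u + occ a v
  occ-++ a []      v = refl
  occ-++ a (c ∷ u) v = trans (cong (_ +_) (occ-++ a u v)) (sym (+-assoc _ (occ a u) (occ a v)))

  occ-++-≤ : ∀ a u v → occ a u ≤ occ a (u ++ v)
  occ-++-≤ a u v = ≤-trans (m≤m+n (occ a u) (occ a v)) (≤-reflexive (sym (occ-++ a u v)))

  Precedes : List A → A → ℕ → A → ℕ → Set
  Precedes w a j b j′ = ∃₂ λ u v → w ≡ u ++ v × j ≤ occ a u × occ b u < j′

  Precedes-++ˡ : ∀ {a b j j′} u v → j′ ≤ occ b u →
    Precedes (u ++ v) a j b j′ ⇔ Precedes u a j b j′
  Precedes-++ˡ {a} {b} {j} {j′} u v j′≤ = mk⇔ to from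
    where
    to : Precedes (u ++ v) a j b j′ → Precedes u a j b j′
    to (p , q , e , ha , hb) with ++-prefixes u v p q e
    ... | inj₁ (s , refl , _) = contradiction (≤-trans j′≤ (occ-++-≤ b u s)) (<⇒≱ hb)
    ... | inj₂ (s , refl)     = p , s , refl , ha , hb
    from : Precedes u a j b j′ → Precedes (u ++ v) a j b j′
    from (p , q , refl , ha , hb) = p , q ++ v , ++-assoc p q v , ha , hb

  Precedes-++ʳ : ∀ {a b j j′} u v → 1 ≤ j →
    Precedes (u ++ v) a (occ a u + j) b (occ b u + j′) ⇔ Precedes v a j b j′
  Precedes-++ʳ {a} {b} {j} {j′} u v 1≤j = mk⇔ to from
    where
    to : Precedes (u ++ v) a (occ a u + j) b (occ b u + j′) → Precedes v a j b j′
    to (p , q , e , ha , hb) with ++-prefixes u v p q e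
    ... | inj₁ (s , refl , v≡) =
      s , q , v≡ ,
      +-cancelˡ-≤ (occ a u) j (occ a s) (subst (_ ≤_) (occ-++ a u s) ha) ,
      +-cancelˡ-< (occ b u) (occ b s) j′ (subst (_< _) (occ-++ b u s) hb)
    ... | inj₂ (s , refl) = contradiction (≤-trans ha (occ-++-≤ a p s)) (<⇒≱ (m<m+n _ 1≤j))
    from : Precedes v a j b j′ → Precedes (u ++ v) a (occ a u + j) b (occ b u + j′)
    from (p , q , refl , ha , hb) =
      u ++ p , q , sym (++-assoc u p q) ,
      subst (_ ≤_) (sym (occ-++ a u p)) (+-monoʳ-≤ (occ a u) ha) ,
      subst (_< _) (sym (occ-++ b u p)) (+-monoʳ-< (occ b u) hb)

  -- The (1-based) position of the j-th occurrence of a in w; it is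
  -- length w when w has fewer than j occurrences of a.
  position : A → ℕ → List A → ℕ
  position a zero    w       = 0
  position a (suc j) []      = 0
  position a (suc j) (c ∷ w) = suc (position a (if ⌊ a ≟ c ⌋ then j else suc j) w)

  position≤length : ∀ a j w → position a j w ≤ length w
  position≤length a zero    w       = z≤n
  position≤length a (suc j) []      = z≤n
  position≤length a (suc j) (c ∷ w) = s≤s (position≤length a _ w)

  position-mono : ∀ a {j j′} w → j ≤ j′ → position a j w ≤ position a j′ w
  position-mono a w       z≤n       = z≤n
  position-mono a []      (s≤s j≤j′) = z≤n
  position-mono a (c ∷ w) (s≤s j≤j′) with a ≟ c
  ... | yes _ = s≤s (position-mono a w j≤j′)
  ... | no  _ = s≤s (position-mono a w (s≤s j≤j′))

  position-≤⇔ : ∀ a j u v → j ≤ occ a (u ++ v) →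
    position a j (u ++ v) ≤ length u ⇔ j ≤ occ a u
  position-≤⇔ a j u v j≤ = mk⇔ (to j u v j≤) (from j u)
    where
    to : ∀ j u v → j ≤ occ a (u ++ v) → position a j (u ++ v) ≤ length u → j ≤ occ a u
    to zero    u       v       _  _  = z≤n
    to (suc j) []      []      () _
    to (suc j) []      (_ ∷ _) _  ()
    to (suc j) (c ∷ u) v       j≤ (s≤s le) with a ≟ c
    ... | yes _ = s≤s (to j u v (≤-pred j≤) le)
    ... | no  _ = to (suc j) u v j≤ le
    from : ∀ j u → j ≤ occ a u → position a j (u ++ v) ≤ length u
    from zero    u       _  = z≤n
    from (suc j) (c ∷ u) j≤ with a ≟ c
    ... | yes _ = s≤s (from j u (≤-pred j≤))
    ... | no  _ = s≤s (from (suc j) u j≤)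

  splitAt-≡ : ∀ (w : List A) t → t ≤ length w → ∃₂ λ u v → w ≡ u ++ v × length u ≡ t
  splitAt-≡ w t t≤ = take t w , drop t w , sym (take++drop≡id t w) ,
    trans (length-take t w) (m≤n⇒m⊓n≡m t≤)

  Precedes⇔position< : ∀ {a b j j′} w → j ≤ occ a w → j′ ≤ occ b w →
    Precedes w a j b j′ ⇔ position a j w < position b j′ w
  Precedes⇔position< {a} {b} {j} {j′} w j≤ j′≤ = mk⇔ to from
    where
    to : Precedes w a j b j′ → position a j w < position b j′ w
    to (u , v , refl , ha , hb) =
      ≤-<-trans (Equivalence.from (position-≤⇔ a j u v j≤) ha)
                (≰⇒> (<⇒≱ hb ∘ Equivalence.to (position-≤⇔ b j′ u v j′≤)))
    from : position a j w < position b j′ w → Precedes w a j b j′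
    from lt with splitAt-≡ w (position a j w) (position≤length a j w)
    ... | u , v , refl , |u| =
      u , v , refl ,
      Equivalence.to (position-≤⇔ a j u v j≤) (≤-reflexive (sym |u|)) ,
      ≰⇒> (<⇒≱ lt ∘ subst (_ ≤_) |u| ∘ Equivalence.from (position-≤⇔ b j′ u v j′≤))

  occ-filter-yes : ∀ {P : A → Set} (P? : Decidable P) {a} → P a → ∀ xs → occ a (filter P? xs) ≡ occ a xs
  occ-filter-yes P? pa []       = refl
  occ-filter-yes P? {a} pa (x ∷ xs) with P? x
  ... | yes _ = cong (_ +_) (occ-filter-yes P? pa xs)
  ... | no ¬px with a ≟ x
  ...   | yes refl = contradiction pa ¬px
  ...   | no  _    = occ-filter-yes P? pa xs

  occ-filter-no : ∀ {P : A → Set} (P? : Decidable P) {a} → ¬ P a → ∀ xs → occ a (filter P? xs) ≡ 0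
  occ-filter-no P? ¬pa []       = refl
  occ-filter-no P? {a} ¬pa (x ∷ xs) with P? x
  ... | no _ = occ-filter-no P? ¬pa xs
  ... | yes px with a ≟ x
  ...   | yes refl = contradiction px ¬pa
  ...   | no  _    = occ-filter-no P? ¬pa xs

  occ⇒∈ : ∀ a w → 1 ≤ occ a w → a ∈ w
  occ⇒∈ a (c ∷ w) h with a ≟ c
  ... | yes a≡c = here a≡c
  ... | no  _   = there (occ⇒∈ a w h)

  occ-concat : ∀ {d} (B : Fin d → List A) a → (∀ i → occ a (B i) ≡ 2) → occ a (concat (tabulate B)) ≡ 2 * d
  occ-concat {zero}  B a twice = refl
  occ-concat {suc d} B a twice = begin
    occ a (B Fin.zero ++ concat (tabulate (B ∘ Fin.suc)))
      ≡⟨ occ-++ a (B Fin.zero) _ ⟩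
    occ a (B Fin.zero) + occ a (concat (tabulate (B ∘ Fin.suc)))
      ≡⟨ cong₂ _+_ (twice Fin.zero) (occ-concat (B ∘ Fin.suc) a (twice ∘ Fin.suc)) ⟩
    2 + 2 * d
      ≡⟨ sym (*-suc 2 d) ⟩
    2 * suc d
      ∎
    where open ≡-Reasoning

  -- With every letter occurring twice in each block, the (2i+1)-th and
  -- (2i+2)-th occurrences of a letter both lie in block i.
  Precedes-concat⇔ : ∀ {d} (B : Fin d → List A) {a b} →
    (∀ i → occ a (B i) ≡ 2) → (∀ i → occ b (B i) ≡ 2) → ∀ i → Precedes (concat (tabulate B)) a (2 + 2 * toℕ i) b (suc (2 * toℕ i)) ⇔ Precedes (B i) a 2 b 1
  Precedes-concat⇔ B twice-a twice-b Fin.zero =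
    Precedes-++ˡ (B Fin.zero) _ (≤-trans (s≤s z≤n) (≤-reflexive (sym (twice-b Fin.zero))))
  Precedes-concat⇔ B {a} {b} twice-a twice-b (Fin.suc i) = Composition.equivalence
    (subst₂ (λ j j′ → Precedes (B Fin.zero ++ rest) a j b j′ ⇔
                      Precedes rest a (2 + 2 * toℕ i) b (suc (2 * toℕ i)))
            (trans (cong (_+ _) (twice-a Fin.zero)) (cong (2 +_) (sym (*-suc 2 (toℕ i)))))
            (trans (cong (_+ _) (twice-b Fin.zero)) (cong suc (sym (*-suc 2 (toℕ i)))))
            (Precedes-++ʳ (B Fin.zero) rest (s≤s z≤n)))
    (Precedes-concat⇔ (B ∘ Fin.suc) (twice-a ∘ Fin.suc) (twice-b ∘ Fin.suc) i)
    where
    rest : List A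
    rest = concat (tabulate (B ∘ Fin.suc))

reached : ℕ → ℕ → ℕ
reached q x = if ⌊ q ≤? x ⌋ then 1 else 0

reached-yes : ∀ {q x} → q ≤ x → reached q x ≡ 1
reached-yes {q} {x} q≤x with q ≤? x
... | yes _   = refl
... | no  q≰x = contradiction q≤x q≰x

reached-no : ∀ {q x} → ¬ q ≤ x → reached q x ≡ 0
reached-no {q} {x} q≰x with q ≤? x
... | yes q≤x = contradiction q≤x q≰x
... | no  _   = refl

reached≤1 : ∀ q x → reached q x ≤ 1
reached≤1 q x with q ≤? x
... | yes _ = ≤-refl
... | no  _ = z≤n

reached-suc : ∀ q x → reached q (suc x) ≡ (if ⌊ suc x ≟ q ⌋ then 1 else 0) + reached q x
reached-suc q x with suc x ≟ q
... | yes refl = trans (reached-yes ≤-refl) (cong suc (sym (reached-no 1+n≰n)))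
... | no  x+1≢q with q ≤? x
...   | yes q≤x = reached-yes (m≤n⇒m≤1+n q≤x)
...   | no  q≰x = reached-no (q≰x ∘ λ q≤x+1 → ≤-pred (≤∧≢⇒< q≤x+1 (x+1≢q ∘ sym)))

module Bin = Occurrences Data.Bool._≟_
open Bin using () renaming (occ to occ₂)

count≡occ₂ : ∀ c w → count c w ≡ occ₂ c w
count≡occ₂ c []      = refl
count≡occ₂ c (b ∷ w) = cong (_ +_) (count≡occ₂ c w)

doubled : Bool → BinWord
doubled c = c ∷ c ∷ not c ∷ not c ∷ []

occ₂-only : ∀ c u → occ₂ (not c) u ≡ 0 → u ≡ replicate (occ₂ c u) c
occ₂-only c     []          _  = refl
occ₂-only false (false ∷ u) e  = cong (false ∷_) (occ₂-only false u e)
occ₂-only true  (true ∷ u)  e  = cong (true ∷_) (occ₂-only true u e)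
occ₂-only false (true ∷ u)  ()
occ₂-only true  (false ∷ u) ()

occ₂≡2-0 : ∀ c u → occ₂ c u ≡ 2 → occ₂ (not c) u ≡ 0 → u ≡ c ∷ c ∷ []
occ₂≡2-0 c u two none = trans (occ₂-only c u none) (cong (λ n → replicate n c) two)

kept : ℕ → ℕ → ℕ
kept k zero    = 0
kept k (suc x) = (if keepOcc k (suc x) then 1 else 0) + kept k x

keepOcc-suc : ∀ k i → keepOcc (suc k) i ≡ ⌊ i ≟ suc (2 * k) ⌋ ∨ ⌊ i ≟ 2 + 2 * k ⌋
keepOcc-suc k i = cong₂ (λ p q → ⌊ i ≟ p ⌋ ∨ ⌊ i ≟ q ⌋) (cong (_∸ 1) (*-suc 2 k)) (*-suc 2 k)

kept≡reached+reached : ∀ k x → kept (suc k) x ≡ reached (suc (2 * k)) x + reached (2 + 2 * k) x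
kept≡reached+reached k zero    = refl
kept≡reached+reached k (suc x) = begin
  (if keepOcc (suc k) (suc x) then 1 else 0) + kept (suc k) x
    ≡⟨ cong₂ _+_ (kept-step (keepOcc-suc k (suc x))) (kept≡reached+reached k x) ⟩
  (ι (suc (2 * k)) + ι (2 + 2 * k)) + (reached (suc (2 * k)) x + reached (2 + 2 * k) x)
    ≡⟨ interchange (ι (suc (2 * k))) (ι (2 + 2 * k)) _ _ ⟩
  (ι (suc (2 * k)) + reached (suc (2 * k)) x) + (ι (2 + 2 * k) + reached (2 + 2 * k) x)
    ≡⟨ sym (cong₂ _+_ (reached-suc (suc (2 * k)) x) (reached-suc (2 + 2 * k) x)) ⟩
  reached (suc (2 * k)) (suc x) + reached (2 + 2 * k) (suc x) ∎
  where
  open ≡-Reasoning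
  ι : ℕ → ℕ
  ι q = if ⌊ suc x ≟ q ⌋ then 1 else 0
  kept-step : ∀ {b} → b ≡ ⌊ suc x ≟ suc (2 * k) ⌋ ∨ ⌊ suc x ≟ 2 + 2 * k ⌋ →
              (if b then 1 else 0) ≡ ι (suc (2 * k)) + ι (2 + 2 * k)
  kept-step refl with suc x ≟ suc (2 * k) | suc x ≟ 2 + 2 * k
  ... | yes refl | yes e = contradiction (sym e) 1+n≢n
  ... | yes _    | no _  = refl
  ... | no _     | yes _ = refl
  ... | no _     | no _  = refl

kept≡2⇔ : ∀ k x → kept (suc k) x ≡ 2 ⇔ 2 + 2 * k ≤ x
kept≡2⇔ k x = mk⇔ to from
  where
  to : kept (suc k) x ≡ 2 → 2 + 2 * k ≤ x
  to e with 2 + 2 * k ≤? x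
  ... | yes le  = le
  ... | no  ¬le = contradiction (begin
    2                                                  ≡⟨ trans (sym e) (kept≡reached+reached k x) ⟩
    reached (suc (2 * k)) x + reached (2 + 2 * k) x    ≡⟨ cong (reached (suc (2 * k)) x +_) (reached-no ¬le) ⟩
    reached (suc (2 * k)) x + 0                        ≡⟨ +-identityʳ _ ⟩
    reached (suc (2 * k)) x                            ≤⟨ reached≤1 _ x ⟩
    1                                                  ∎) λ { (s≤s ()) }
    where open ≤-Reasoning
  from : 2 + 2 * k ≤ x → kept (suc k) x ≡ 2
  from le = trans (kept≡reached+reached k x) (cong₂ _+_ (reached-yes (≤-trans (n≤1+n _) le)) (reached-yes le))

kept≡0⇔ : ∀ k x → kept (suc k) x ≡ 0 ⇔ x ≤ 2 * k
kept≡0⇔ k x = mk⇔ to from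
  where
  to : kept (suc k) x ≡ 0 → x ≤ 2 * k
  to e with suc (2 * k) ≤? x
  ... | yes le  = contradiction
    (trans (cong (_+ reached (2 + 2 * k) x) (sym (reached-yes le))) (trans (sym (kept≡reached+reached k x)) e))
    λ ()
  ... | no  ¬le = ≤-pred (≰⇒> ¬le)
  from : x ≤ 2 * k → kept (suc k) x ≡ 0
  from le = trans (kept≡reached+reached k x)
    (cong₂ _+_ (reached-no (<⇒≱ (s≤s le))) (reached-no (<⇒≱ (s≤s (m≤n⇒m≤1+n le)))))

counter : Bool → ℕ → ℕ → ℕ
counter c c₀ c₁ = if c then c₁ else c₀

δgo-occ : ∀ k c c₀ c₁ z →
  occ₂ c (δgo k c₀ c₁ z) + kept k (counter c c₀ c₁) ≡ kept k (counter c c₀ c₁ + occ₂ c z)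
δgo-occ k c c₀ c₁ [] = cong (kept k) (sym (+-identityʳ (counter c c₀ c₁)))
δgo-occ k false c₀ c₁ (false ∷ z) rewrite +-suc c₀ (occ₂ false z)
  with keepOcc k (suc c₀) | δgo-occ k false (suc c₀) c₁ z
... | true  | ih = trans (sym (+-suc _ _)) ih
... | false | ih = ih
δgo-occ k true c₀ c₁ (true ∷ z) rewrite +-suc c₁ (occ₂ true z)
  with keepOcc k (suc c₁) | δgo-occ k true c₀ (suc c₁) z
... | true  | ih = trans (sym (+-suc _ _)) ih
... | false | ih = ih
δgo-occ k true c₀ c₁ (false ∷ z) with keepOcc k (suc c₀)
... | true  = δgo-occ k true (suc c₀) c₁ z
... | false = δgo-occ k true (suc c₀) c₁ z
δgo-occ k false c₀ c₁ (true ∷ z) with keepOcc k (suc c₁)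
... | true  = δgo-occ k false c₀ (suc c₁) z
... | false = δgo-occ k false c₀ (suc c₁) z

δkk-occ : ∀ k c u → occ₂ c (δkk k u) ≡ kept k (occ₂ c u)
δkk-occ k false u = trans (sym (+-identityʳ _)) (δgo-occ k false 0 0 u)
δkk-occ k true  u = trans (sym (+-identityʳ _)) (δgo-occ k true 0 0 u)

δrest : ℕ → BinWord → BinWord → BinWord
δrest k u v = δgo k (occ₂ false u) (occ₂ true u) v

δrest-occ : ∀ k c u v → occ₂ c (δrest k u v) + kept k (occ₂ c u) ≡ kept k (occ₂ c u + occ₂ c v)
δrest-occ k false u v = δgo-occ k false _ _ v
δrest-occ k true  u v = δgo-occ k true  _ _ v

δgo-++ : ∀ k c₀ c₁ u v →
  δgo k c₀ c₁ (u ++ v) ≡ δgo k c₀ c₁ u ++ δgo k (c₀ + occ₂ false u) (c₁ + occ₂ true u) v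
δgo-++ k c₀ c₁ [] v rewrite +-identityʳ c₀ | +-identityʳ c₁ = refl
δgo-++ k c₀ c₁ (false ∷ u) v rewrite +-suc c₀ (occ₂ false u) with keepOcc k (suc c₀)
... | true  = cong (false ∷_) (δgo-++ k (suc c₀) c₁ u v)
... | false = δgo-++ k (suc c₀) c₁ u v
δgo-++ k c₀ c₁ (true ∷ u) v rewrite +-suc c₁ (occ₂ true u) with keepOcc k (suc c₁)
... | true  = cong (true ∷_) (δgo-++ k c₀ (suc c₁) u v)
... | false = δgo-++ k c₀ (suc c₁) u v

δgo-prefix : ∀ k c₀ c₁ z x y → δgo k c₀ c₁ z ≡ x ++ y →
  ∃₂ λ u v → z ≡ u ++ v × δgo k c₀ c₁ u ≡ x
δgo-prefix k c₀ c₁ z [] y e = [] , z , refl , refl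
δgo-prefix k c₀ c₁ [] (_ ∷ _) y ()
δgo-prefix k c₀ c₁ (false ∷ z) (x₀ ∷ x) y e with keepOcc k (suc c₀) in keep
... | true with ∷-injective e
...   | refl , e′ with δgo-prefix k (suc c₀) c₁ z x y e′
...     | u , v , refl , δu = false ∷ u , v , refl , trans (BoolP.if-cong keep) (cong (false ∷_) δu)
δgo-prefix k c₀ c₁ (false ∷ z) (x₀ ∷ x) y e | false with δgo-prefix k (suc c₀) c₁ z (x₀ ∷ x) y e
...     | u , v , refl , δu = false ∷ u , v , refl , trans (BoolP.if-cong keep) δu
δgo-prefix k c₀ c₁ (true ∷ z) (x₀ ∷ x) y e with keepOcc k (suc c₁) in keep
... | true with ∷-injective e
...   | refl , e′ with δgo-prefix k c₀ (suc c₁) z x y e′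
...     | u , v , refl , δu = true ∷ u , v , refl , trans (BoolP.if-cong keep) (cong (true ∷_) δu)
δgo-prefix k c₀ c₁ (true ∷ z) (x₀ ∷ x) y e | false with δgo-prefix k c₀ (suc c₁) z (x₀ ∷ x) y e
...     | u , v , refl , δu = true ∷ u , v , refl , trans (BoolP.if-cong keep) δu

occ₂-cc : ∀ c → occ₂ c (c ∷ c ∷ []) ≡ 2
occ₂-cc false = refl
occ₂-cc true  = refl

occ₂-¬cc : ∀ c → occ₂ (not c) (c ∷ c ∷ []) ≡ 0
occ₂-¬cc false = refl
occ₂-¬cc true  = refl

-- A prefix u keeps kept (suc k) (occ₂ c u) letters c under δ, and this is 2
-- for at least 2k+2 occurrences and 0 for at most 2k; so δ(z) = c c c̄ c̄ exactly
-- when some prefix has at least 2k+2 letters c but at most 2k letters c̄.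
δkk≡doubled⇔Precedes : ∀ k c z → 2 + 2 * k ≤ occ₂ c z → 2 + 2 * k ≤ occ₂ (not c) z →
  δkk (suc k) z ≡ doubled c ⇔ Bin.Precedes z c (2 + 2 * k) (not c) (suc (2 * k))
δkk≡doubled⇔Precedes k c z c-many ¬c-many = mk⇔ to from
  where
  to : δkk (suc k) z ≡ doubled c → Bin.Precedes z c (2 + 2 * k) (not c) (suc (2 * k))
  to e with δgo-prefix (suc k) 0 0 z (c ∷ c ∷ []) (not c ∷ not c ∷ []) e
  ... | u , v , refl , δu = u , v , refl ,
    Equivalence.to (kept≡2⇔ k _) (begin
      kept (suc k) (occ₂ c u)  ≡⟨ sym (δkk-occ (suc k) c u) ⟩
      occ₂ c (δkk (suc k) u)   ≡⟨ cong (occ₂ c) δu ⟩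
      occ₂ c (c ∷ c ∷ [])      ≡⟨ occ₂-cc c ⟩
      2                        ∎) ,
    s≤s (Equivalence.to (kept≡0⇔ k _) (begin
      kept (suc k) (occ₂ (not c) u)     ≡⟨ sym (δkk-occ (suc k) (not c) u) ⟩
      occ₂ (not c) (δkk (suc k) u)      ≡⟨ cong (occ₂ (not c)) δu ⟩
      occ₂ (not c) (c ∷ c ∷ [])         ≡⟨ occ₂-¬cc c ⟩
      0                                 ∎))
    where open ≡-Reasoning
  from : Bin.Precedes z c (2 + 2 * k) (not c) (suc (2 * k)) → δkk (suc k) z ≡ doubled c
  from (u , v , refl , c-enough , ¬c-few) =
    trans (δgo-++ (suc k) 0 0 u v) (cong₂ _++_ δu δv)
    where
    δr : BinWord
    δr = δrest (suc k) u v
    kept-u-c : kept (suc k) (occ₂ c u) ≡ 2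
    kept-u-c = Equivalence.from (kept≡2⇔ k _) c-enough
    kept-u-¬c : kept (suc k) (occ₂ (not c) u) ≡ 0
    kept-u-¬c = Equivalence.from (kept≡0⇔ k _) (≤-pred ¬c-few)
    δrest-occ-total : ∀ c′ → 2 + 2 * k ≤ occ₂ c′ (u ++ v) →
      occ₂ c′ δr + kept (suc k) (occ₂ c′ u) ≡ 2
    δrest-occ-total c′ many = trans (δrest-occ (suc k) c′ u v)
      (trans (cong (kept (suc k)) (sym (Bin.occ-++ c′ u v))) (Equivalence.from (kept≡2⇔ k _) many))
    δu : δkk (suc k) u ≡ c ∷ c ∷ []
    δu = occ₂≡2-0 c _ (trans (δkk-occ (suc k) c u) kept-u-c)
                      (trans (δkk-occ (suc k) (not c) u) kept-u-¬c)
    δr-¬c : occ₂ (not c) δr ≡ 2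
    δr-¬c = begin
      occ₂ (not c) δr                                  ≡⟨ sym (+-identityʳ _) ⟩
      occ₂ (not c) δr + 0                              ≡⟨ cong (occ₂ (not c) δr +_) (sym kept-u-¬c) ⟩
      occ₂ (not c) δr + kept (suc k) (occ₂ (not c) u)  ≡⟨ δrest-occ-total (not c) ¬c-many ⟩
      2                                                ∎
      where open ≡-Reasoning
    δr-c : occ₂ c δr ≡ 0
    δr-c = +-cancelʳ-≡ 2 _ 0 (trans (cong (occ₂ c δr +_) (sym kept-u-c)) (δrest-occ-total c c-many))
    δv : δr ≡ not c ∷ not c ∷ []
    δv = occ₂≡2-0 (not c) δr δr-¬c (subst (λ c′ → occ₂ c′ δr ≡ 0) (sym (BoolP.not-involutive c)) δr-c)

open module Letters {m} = Occurrences (FinP._≟_ {m})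

letter : ∀ {m} → Fin m → Fin m → Bool → Fin m
letter a b c = if c then b else a

hom-occ : ∀ {m} {a b : Fin m} → a ≢ b → ∀ c w → occ₂ c (hom a b w) ≡ occ (letter a b c) w
hom-occ a≢b c [] = refl
hom-occ {a = a} {b} a≢b false (x ∷ w) with a FinP.≟ x | b FinP.≟ x
... | yes _ | _     = cong suc (hom-occ a≢b false w)
... | no _  | yes _ = hom-occ a≢b false w
... | no _  | no _  = hom-occ a≢b false w
hom-occ {a = a} {b} a≢b true (x ∷ w) with a FinP.≟ x | b FinP.≟ x
... | yes refl | yes refl = contradiction refl a≢b
... | yes _    | no _     = hom-occ a≢b true w
... | no _     | yes _    = cong suc (hom-occ a≢b true w)
... | no _     | no _     = hom-occ a≢b true w

hom-++ : ∀ {m} (a b : Fin m) u v → hom a b (u ++ v) ≡ hom a b u ++ hom a b v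
hom-++ a b []      v = refl
hom-++ a b (x ∷ u) v with a FinP.≟ x | b FinP.≟ x
... | yes _ | _     = cong (false ∷_) (hom-++ a b u v)
... | no _  | yes _ = cong (true ∷_) (hom-++ a b u v)
... | no _  | no _  = hom-++ a b u v

hom-∷ᵃ : ∀ {m} (a b : Fin m) u → hom a b (a ∷ u) ≡ false ∷ hom a b u
hom-∷ᵃ a b u with a FinP.≟ a
... | yes _   = refl
... | no  a≢a = contradiction refl a≢a

hom-∷ᵇ : ∀ {m} {a b : Fin m} u → a ≢ b → hom a b (b ∷ u) ≡ true ∷ hom a b u
hom-∷ᵇ {a = a} {b} u a≢b with a FinP.≟ b | b FinP.≟ b
... | yes a≡b | _       = contradiction a≡b a≢b
... | no _    | yes _   = refl
... | no _    | no  b≢b = contradiction refl b≢b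

hom-∷-other : ∀ {m} {a b c : Fin m} u → a ≢ c → b ≢ c → hom a b (c ∷ u) ≡ hom a b u
hom-∷-other {a = a} {b} {c} u a≢c b≢c with a FinP.≟ c | b FinP.≟ c
... | yes a≡c | _       = contradiction a≡c a≢c
... | no _    | yes b≡c = contradiction b≡c b≢c
... | no _    | no _    = refl

hom-prefix : ∀ {m} (a b : Fin m) w x y → hom a b w ≡ x ++ y → ∃₂ λ u v → w ≡ u ++ v × hom a b u ≡ x
hom-prefix a b w [] y e = [] , w , refl , refl
hom-prefix a b [] (_ ∷ _) y ()
hom-prefix a b (c ∷ w) (x₀ ∷ x) y e with a FinP.≟ c | b FinP.≟ c
... | yes refl | _ with ∷-injective e
...   | refl , e′ with hom-prefix a b w x y e′
...     | u , v , refl , hu = a ∷ u , v , refl , trans (hom-∷ᵃ a b u) (cong (false ∷_) hu)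
hom-prefix a b (c ∷ w) (x₀ ∷ x) y e | no a≢c | yes refl with ∷-injective e
...   | refl , e′ with hom-prefix a b w x y e′
...     | u , v , refl , hu = b ∷ u , v , refl , trans (hom-∷ᵇ u a≢c) (cong (true ∷_) hu)
hom-prefix a b (c ∷ w) (x₀ ∷ x) y e | no a≢c | no b≢c with hom-prefix a b w (x₀ ∷ x) y e
...     | u , v , refl , hu = c ∷ u , v , refl , trans (hom-∷-other u a≢c b≢c) hu

hom-Precedes : ∀ {m} {a b : Fin m} → a ≢ b → ∀ w c j c′ j′ →
  Bin.Precedes (hom a b w) c j c′ j′ ⇔ Precedes w (letter a b c) j (letter a b c′) j′
hom-Precedes {a = a} {b} a≢b w c j c′ j′ = mk⇔ to from
  where
  to : Bin.Precedes (hom a b w) c j c′ j′ → Precedes w (letter a b c) j (letter a b c′) j′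
  to (x , y , e , hc , hc′) with hom-prefix a b w x y e
  ... | u , v , refl , refl =
    u , v , refl , subst (j ≤_) (hom-occ a≢b c u) hc , subst (_< j′) (hom-occ a≢b c′ u) hc′
  from : Precedes w (letter a b c) j (letter a b c′) j′ → Bin.Precedes (hom a b w) c j c′ j′
  from (u , v , refl , hc , hc′) =
    hom a b u , hom a b v , hom-++ a b u v ,
    subst (j ≤_) (sym (hom-occ a≢b c u)) hc , subst (_< j′) (sym (hom-occ a≢b c′ u)) hc′

doubled∈ : ∀ c → doubled c ≡ w0011 ⊎ doubled c ≡ w1100
doubled∈ false = inj₁ refl
doubled∈ true  = inj₂ refl

Lidim⇔ : ∀ d z → Lidim d z ⇔
  (IsUniformWord (2 * d) z × ∃[ c ] ∀ (i : Fin d) → δkk (suc (toℕ i)) z ≡ doubled c)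
Lidim⇔ d z = mk⇔ to from
  where
  to : Lidim d z → IsUniformWord (2 * d) z × ∃[ c ] ∀ (i : Fin d) → δkk (suc (toℕ i)) z ≡ doubled c
  to (u , _ , inj₁ refl , f) = u , false , λ i → f (suc (toℕ i)) (s≤s z≤n) (FinP.toℕ<n i)
  to (u , _ , inj₂ refl , f) = u , true  , λ i → f (suc (toℕ i)) (s≤s z≤n) (FinP.toℕ<n i)
  from : IsUniformWord (2 * d) z × ∃[ c ] (∀ (i : Fin d) → δkk (suc (toℕ i)) z ≡ doubled c) → Lidim d z
  from (u , c , g) = u , doubled c , doubled∈ c , λ
    { zero    ()  _
    ; (suc k) _   k<d → subst (λ j → δkk (suc j) z ≡ doubled c) (FinP.toℕ-fromℕ< k<d) (g (fromℕ< k<d)) }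

Separated : ∀ {m} → ℕ → List (Fin m) → Fin m → Fin m → Set
Separated d w a b = ∀ (i : Fin d) → Precedes w a (2 + 2 * toℕ i) b (suc (2 * toℕ i))

2+2i≤2d : ∀ {d} (i : Fin d) → 2 + 2 * toℕ i ≤ 2 * d
2+2i≤2d {d} i = subst (_≤ 2 * d) (*-suc 2 (toℕ i)) (*-monoʳ-≤ 2 (FinP.toℕ<n i))

Lidim-hom⇔ : ∀ {m} d (w : List (Fin m)) {a b} → a ≢ b → occ a w ≡ 2 * d → occ b w ≡ 2 * d →
  Lidim d (hom a b w) ⇔ (Separated d w a b ⊎ Separated d w b a)
Lidim-hom⇔ d w {a} {b} a≢b occ-a occ-b = mk⇔ to from
  where
  occ-hom : ∀ c → occ₂ c (hom a b w) ≡ 2 * d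
  occ-hom false = trans (hom-occ a≢b false w) occ-a
  occ-hom true  = trans (hom-occ a≢b true w) occ-b
  uniform : IsUniformWord (2 * d) (hom a b w)
  uniform = trans (count≡occ₂ false (hom a b w)) (occ-hom false) ,
            trans (count≡occ₂ true (hom a b w)) (occ-hom true)
  round⇔ : ∀ c (i : Fin d) → δkk (suc (toℕ i)) (hom a b w) ≡ doubled c ⇔
    Precedes w (letter a b c) (2 + 2 * toℕ i) (letter a b (not c)) (suc (2 * toℕ i))
  round⇔ c i = Composition.equivalence
    (δkk≡doubled⇔Precedes (toℕ i) c _ (subst (_ ≤_) (sym (occ-hom c)) (2+2i≤2d i))
                                      (subst (_ ≤_) (sym (occ-hom (not c))) (2+2i≤2d i)))
    (hom-Precedes a≢b w c _ (not c) _)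
  to : Lidim d (hom a b w) → Separated d w a b ⊎ Separated d w b a
  to l with Equivalence.to (Lidim⇔ d (hom a b w)) l
  ... | _ , false , g = inj₁ λ i → Equivalence.to (round⇔ false i) (g i)
  ... | _ , true  , g = inj₂ λ i → Equivalence.to (round⇔ true i) (g i)
  from : Separated d w a b ⊎ Separated d w b a → Lidim d (hom a b w)
  from (inj₁ s) = Equivalence.from (Lidim⇔ d (hom a b w))
    (uniform , false , λ i → Equivalence.from (round⇔ false i) (s i))
  from (inj₂ s) = Equivalence.from (Lidim⇔ d (hom a b w))
    (uniform , true , λ i → Equivalence.from (round⇔ true i) (s i))

toℚ : ℕ → ℚ
toℚ n = mkℚ (ℤ.+ n) 0 (Coprime.sym (Coprime.1-coprimeTo n))

toℚ-mono-≤ : ∀ {m n} → m ≤ n → toℚ m ℚ.≤ toℚ n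
toℚ-mono-≤ {m} {n} m≤n =
  ℚ.*≤* (subst₂ ℤ._≤_ (sym (ZP.*-identityʳ (ℤ.+ m))) (sym (ZP.*-identityʳ (ℤ.+ n))) (ℤ.+≤+ m≤n))

toℚ-<⇔ : ∀ {m n} → toℚ m ℚ.< toℚ n ⇔ m < n
toℚ-<⇔ {m} {n} = mk⇔
  (λ { (ℚ.*<* lt) → ZP.drop‿+<+ (subst₂ ℤ._<_ (ZP.*-identityʳ (ℤ.+ m)) (ZP.*-identityʳ (ℤ.+ n)) lt) })
  (λ lt → ℚ.*<* (subst₂ ℤ._<_ (sym (ZP.*-identityʳ (ℤ.+ m))) (sym (ZP.*-identityʳ (ℤ.+ n))) (ℤ.+<+ lt)))

ℕIntervalRep : ℕ → Set
ℕIntervalRep n = Σ (Fin n → ℕ) λ lo → Σ (Fin n → ℕ) λ hi → ∀ x → lo x ≤ hi x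

toIntervalRep : ∀ {n} → ℕIntervalRep n → IntervalRep n
toIntervalRep (lo , hi , lo≤hi) = toℚ ∘ lo , toℚ ∘ hi , toℚ-mono-≤ ∘ lo≤hi

reindex : ∀ {m n} → (Fin n → Fin m) → IntervalRep m → IntervalRep n
reindex f (lo , hi , lo≤hi) = lo ∘ f , hi ∘ f , lo≤hi ∘ f

intersection-isStrictPartialOrder : ∀ {n d} → Fin d → (I : Fin d → IntervalRep n) →
  IsStrictPartialOrder _≡_ (λ x y → ∀ i → IntervalPrec (I i) x y)
intersection-isStrictPartialOrder i₀ I = record
  { isEquivalence = isEquivalence
  ; irrefl   = λ { {x} refl x≺x → QP.<-irrefl refl (QP.≤-<-trans (lo≤hi i₀ x) (x≺x i₀)) }
  ; trans    = λ {_} {y} x≺y y≺z i → QP.<-trans (QP.<-≤-trans (x≺y i) (lo≤hi i y)) (y≺z i)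
  ; <-resp-≈ = (λ { refl x≺y → x≺y }) , (λ { refl x≺y → x≺y })
  }
  where
  lo≤hi : ∀ i x → proj₁ (I i) x ℚ.≤ proj₁ (proj₂ (I i)) x
  lo≤hi i = proj₂ (proj₂ (I i))

module WordIntervals {m} (d : ℕ) (w : List (Fin m)) where

  Regular : Fin m → Set
  Regular a = occ a w ≡ 2 * d

  -- A letter occurring other than 2d times is isolated in G(Lidim d, w);
  -- it gets the interval [0, length w], which meets every other one.
  endpoints : ∀ {a} → Dec (Regular a) → Fin d → ℕ × ℕ
  endpoints {a} (yes _) i = position a (suc (2 * toℕ i)) w , position a (2 + 2 * toℕ i) w
  endpoints     (no _)  i = 0 , length w

  endpoints-ordered : ∀ {a} (da : Dec (Regular a)) i → proj₁ (endpoints da i) ≤ proj₂ (endpoints da i)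
  endpoints-ordered {a} (yes _) i = position-mono a w (n≤1+n _)
  endpoints-ordered     (no _)  i = z≤n

  endpoints-bounded : ∀ {a} (da : Dec (Regular a)) i → proj₁ (endpoints da i) ≤ length w
  endpoints-bounded {a} (yes _) i = position≤length a _ w
  endpoints-bounded     (no _)  i = z≤n

  Before : ∀ {a b} → Dec (Regular a) → Dec (Regular b) → Set
  Before da db = ∀ i → proj₂ (endpoints da i) < proj₁ (endpoints db i)

  Separated⇔Before : ∀ {a b} (ra : Regular a) (rb : Regular b) →
    Separated d w a b ⇔ Before (yes ra) (yes rb)
  Separated⇔Before {a} {b} ra rb = mk⇔
    (λ s i → Equivalence.to (precedes⇔ i) (s i)) (λ s i → Equivalence.from (precedes⇔ i) (s i))
    where
    precedes⇔ : ∀ i → Precedes w a (2 + 2 * toℕ i) b (suc (2 * toℕ i)) ⇔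
                      position a (2 + 2 * toℕ i) w < position b (suc (2 * toℕ i)) w
    precedes⇔ i = Precedes⇔position< w (subst (_ ≤_) (sym ra) (2+2i≤2d i))
                                       (subst (_ ≤_) (sym rb) (≤-trans (n≤1+n _) (2+2i≤2d i)))

  Lidim-hom-regular : ∀ {a b} → a ≢ b → Lidim d (hom a b w) → Regular a × Regular b
  Lidim-hom-regular {a} {b} a≢b ((count-0 , count-1) , _) =
    trans (sym (hom-occ a≢b false w)) (trans (sym (count≡occ₂ false (hom a b w))) count-0) ,
    trans (sym (hom-occ a≢b true w)) (trans (sym (count≡occ₂ true (hom a b w))) count-1)

  Lidim-hom⇔Before : ∀ {a b} → Fin d → a ≢ b → (da : Dec (Regular a)) (db : Dec (Regular b)) →
    Lidim d (hom a b w) ⇔ (Before da db ⊎ Before db da)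
  Lidim-hom⇔Before i₀ a≢b (yes ra) (yes rb) =
    Composition.equivalence (Lidim-hom⇔ d w a≢b ra rb) (Separated⇔Before ra rb ⊎-⇔ Separated⇔Before rb ra)
  Lidim-hom⇔Before i₀ a≢b (no ¬ra) db = mk⇔
    (λ l → contradiction (proj₁ (Lidim-hom-regular a≢b l)) ¬ra)
    [ (λ ab → contradiction (endpoints-bounded db i₀) (<⇒≱ (ab i₀)))
    , (λ ba → contradiction (ba i₀) λ ()) ]
  Lidim-hom⇔Before i₀ a≢b (yes ra) (no ¬rb) = mk⇔
    (λ l → contradiction (proj₂ (Lidim-hom-regular a≢b l)) ¬rb)
    [ (λ ab → contradiction (ab i₀) λ ())
    , (λ ba → contradiction (endpoints-bounded (yes ra) i₀) (<⇒≱ (ba i₀))) ]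

  intervals : Fin d → ℕIntervalRep m
  intervals i = (λ a → proj₁ (endpoints (occ a w ≟ 2 * d) i)) ,
                (λ a → proj₂ (endpoints (occ a w ≟ 2 * d) i)) ,
                (λ a → endpoints-ordered (occ a w ≟ 2 * d) i)

InGraphClass⇒IsCompGraphIdimAtMost : ∀ d → 1 ≤ d → ∀ {n} (E : Fin n → Fin n → Set) →
  InGraphClass (Lidim d) E → IsCompGraphIdimAtMost d E
InGraphClass⇒IsCompGraphIdimAtMost d 1≤d E (m , w , _ , f , (f-injective , _) , E⇔) =
  _≺_ , intersection-isStrictPartialOrder i₀ I , (d , ≤-refl , I , λ _ _ → Identity.⇔-id _) , comparability
  where
  open WordIntervals d w
  i₀ : Fin d
  i₀ = fromℕ< 1≤d
  I : Fin d → IntervalRep _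
  I i = reindex f (toIntervalRep (intervals i))
  _≺_ : Fin _ → Fin _ → Set
  u ≺ v = ∀ i → IntervalPrec (I i) u v
  Before⇔≺ : ∀ u v → Before (occ (f u) w ≟ 2 * d) (occ (f v) w ≟ 2 * d) ⇔ u ≺ v
  Before⇔≺ u v = mk⇔ (λ h i → Equivalence.from toℚ-<⇔ (h i)) (λ h i → Equivalence.to toℚ-<⇔ (h i))
  comparability : IsComparabilityGraphOf E _≺_
  comparability u v = Composition.equivalence (E⇔ u v) (mk⇔ to from)
    where
    Lidim⇔≺ : f u ≢ f v → Lidim d (hom (f u) (f v) w) ⇔ (u ≺ v ⊎ v ≺ u)
    Lidim⇔≺ fu≢fv = Composition.equivalence
      (Lidim-hom⇔Before i₀ fu≢fv (occ (f u) w ≟ 2 * d) (occ (f v) w ≟ 2 * d))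
      (Before⇔≺ u v ⊎-⇔ Before⇔≺ v u)
    to : GAdj (Lidim d) w (f u) (f v) → u ≢ v × (u ≺ v ⊎ v ≺ u)
    to (fu≢fv , l) = fu≢fv ∘ cong f , Equivalence.to (Lidim⇔≺ fu≢fv) l
    from : u ≢ v × (u ≺ v ⊎ v ≺ u) → GAdj (Lidim d) w (f u) (f v)
    from (u≢v , h) = u≢v ∘ f-injective , Equivalence.from (Lidim⇔≺ (u≢v ∘ f-injective)) h

module _ {A : Set} {P Q : A → Set} (P? : Decidable P) (Q? : Decidable Q) (P⇒Q : ∀ {x} → P x → Q x) where

  length-filter-mono : ∀ xs → length (filter P? xs) ≤ length (filter Q? xs)
  length-filter-mono []       = z≤n
  length-filter-mono (x ∷ xs) with P? x | Q? x
  ... | yes _ | yes _  = s≤s (length-filter-mono xs)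
  ... | yes p | no ¬q  = contradiction (P⇒Q p) ¬q
  ... | no _  | yes _  = m≤n⇒m≤1+n (length-filter-mono xs)
  ... | no _  | no _   = length-filter-mono xs

  length-filter-mono-< : ∀ {x} xs → x ∈ xs → ¬ P x → Q x → length (filter P? xs) < length (filter Q? xs)
  length-filter-mono-< (x ∷ xs) (here refl) ¬p q with P? x | Q? x
  ... | yes p | _     = contradiction p ¬p
  ... | no _  | yes _ = s≤s (length-filter-mono xs)
  ... | no _  | no ¬q = contradiction q ¬q
  length-filter-mono-< (y ∷ xs) (there x∈xs) ¬p q with P? y | Q? y
  ... | yes _ | yes _  = s≤s (length-filter-mono-< xs x∈xs ¬p q)
  ... | yes p | no ¬q  = contradiction (P⇒Q p) ¬q
  ... | no _  | yes _  = m<n⇒m<1+n (length-filter-mono-< xs x∈xs ¬p q)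
  ... | no _  | no _   = length-filter-mono-< xs x∈xs ¬p q

occ-map-suc : ∀ {m} (a : Fin m) xs → occ (Fin.suc a) (map Fin.suc xs) ≡ occ a xs
occ-map-suc a []       = refl
occ-map-suc a (x ∷ xs) with a FinP.≟ x
... | yes _ = cong suc (occ-map-suc a xs)
... | no  _ = occ-map-suc a xs

occ-zero-map-suc : ∀ {m} (xs : List (Fin m)) → occ Fin.zero (map Fin.suc xs) ≡ 0
occ-zero-map-suc []       = refl
occ-zero-map-suc (x ∷ xs) = occ-zero-map-suc xs

occ-allFin : ∀ {n} (a : Fin n) → occ a (allFin n) ≡ 1
occ-allFin {suc n} a = trans (cong (occ a) (cong (Fin.zero ∷_) (sym (map-tabulate id Fin.suc)))) (go a)
  where
  go : ∀ a → occ a (Fin.zero ∷ map Fin.suc (allFin n)) ≡ 1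
  go Fin.zero    = cong suc (occ-zero-map-suc (allFin n))
  go (Fin.suc a) = trans (occ-map-suc a (allFin n)) (occ-allFin a)

occ-filter-allFin : ∀ {n} {P : Fin n → Set} (P? : Decidable P) a →
  occ a (filter P? (allFin n)) ≡ (if ⌊ P? a ⌋ then 1 else 0)
occ-filter-allFin P? a with P? a
... | yes pa = trans (occ-filter-yes P? pa (allFin _)) (occ-allFin a)
... | no ¬pa = occ-filter-no P? ¬pa (allFin _)

-- Each letter is written at the two times lo a and hi a, time running from 1.
module EventWord {n} (lo hi : Fin n → ℕ) where

  slot : ℕ → List (Fin n)
  slot s = filter (λ c → s ≟ lo c) (allFin n) ++ filter (λ c → s ≟ hi c) (allFin n)

  events : ℕ → List (Fin n)
  events zero    = []
  events (suc t) = events t ++ slot (suc t)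

  occ-slot : ∀ a s → occ a (slot s) ≡ (if ⌊ s ≟ lo a ⌋ then 1 else 0) + (if ⌊ s ≟ hi a ⌋ then 1 else 0)
  occ-slot a s = trans (occ-++ a (filter (λ c → s ≟ lo c) (allFin n)) _)
    (cong₂ _+_ (occ-filter-allFin (λ c → s ≟ lo c) a) (occ-filter-allFin (λ c → s ≟ hi c) a))

  events-prefix : ∀ {t T} → t ≤ T → ∃ λ R → events T ≡ events t ++ R
  events-prefix {T = zero} z≤n = [] , refl
  events-prefix {t} {suc T} t≤T+1 with m≤n⇒m<n∨m≡n t≤T+1
  ... | inj₂ refl = [] , sym (++-identityʳ (events t))
  ... | inj₁ t<T+1 with events-prefix (≤-pred t<T+1)
  ...   | R , e = R ++ slot (suc T) , trans (cong (_++ slot (suc T)) e) (++-assoc (events t) R _)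

  module _ (positive : ∀ a → 1 ≤ lo a) (ordered : ∀ a → lo a ≤ hi a) where

    occ-events : ∀ a t → occ a (events t) ≡ reached (lo a) t + reached (hi a) t
    occ-events a zero = sym (cong₂ _+_ (reached-no (<⇒≱ (positive a)))
                                       (reached-no (<⇒≱ (≤-trans (positive a) (ordered a)))))
    occ-events a (suc t) = begin
      occ a (events t ++ slot (suc t))                   ≡⟨ occ-++ a (events t) _ ⟩
      occ a (events t) + occ a (slot (suc t))            ≡⟨ cong₂ _+_ (occ-events a t) (occ-slot a (suc t)) ⟩
      (reached (lo a) t + reached (hi a) t) + (ι (lo a) + ι (hi a))
        ≡⟨ +-comm (reached (lo a) t + reached (hi a) t) _ ⟩
      (ι (lo a) + ι (hi a)) + (reached (lo a) t + reached (hi a) t)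
        ≡⟨ interchange (ι (lo a)) _ _ _ ⟩
      (ι (lo a) + reached (lo a) t) + (ι (hi a) + reached (hi a) t)
        ≡⟨ sym (cong₂ _+_ (reached-suc (lo a) t) (reached-suc (hi a) t)) ⟩
      reached (lo a) (suc t) + reached (hi a) (suc t)    ∎
      where
      open ≡-Reasoning
      ι : ℕ → ℕ
      ι q = if ⌊ suc t ≟ q ⌋ then 1 else 0

    module _ (S : ℕ) (bounded : ∀ a → hi a ≤ S) (disjoint : ∀ a b → lo b ≢ hi a) where

      occ-events-S : ∀ a → occ a (events S) ≡ 2
      occ-events-S a = trans (occ-events a S)
        (cong₂ _+_ (reached-yes (≤-trans (ordered a) (bounded a))) (reached-yes (bounded a)))

      Precedes-events⇔ : ∀ a b → Precedes (events S) a 2 b 1 ⇔ hi a < lo b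
      Precedes-events⇔ a b = mk⇔ to from
        where
        open ≤-Reasoning
        from : hi a < lo b → Precedes (events S) a 2 b 1
        from ha<lb with events-prefix (bounded a)
        ... | R , e = events (hi a) , R , e ,
          ≤-reflexive (sym (trans (occ-events a (hi a))
            (cong₂ _+_ (reached-yes (ordered a)) (reached-yes ≤-refl)))) ,
          ≤-reflexive (cong suc (trans (occ-events b (hi a))
            (cong₂ _+_ (reached-no (<⇒≱ ha<lb)) (reached-no (<⇒≱ (<-≤-trans ha<lb (ordered b)))))))
        -- the prefix events (lo b) already contains a b but at most one a
        not-before : lo b < hi a → ¬ Precedes (events S) a 2 b 1
        not-before lb<ha (p , q , e , ha , hb) with events-prefix (≤-trans (<⇒≤ lb<ha) (bounded a))
        ... | R , eS with ++-prefixes (events (lo b)) R p q (trans (sym eS) e)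
        ...   | inj₁ (s , refl , _) = contradiction (begin
          1                                                   ≡⟨ sym (reached-yes ≤-refl) ⟩
          reached (lo b) (lo b)                               ≤⟨ m≤m+n _ _ ⟩
          reached (lo b) (lo b) + reached (hi b) (lo b)       ≡⟨ sym (occ-events b (lo b)) ⟩
          occ b (events (lo b))                               ≤⟨ occ-++-≤ b (events (lo b)) s ⟩
          occ b (events (lo b) ++ s)                          ∎) (<⇒≱ hb)
        ...   | inj₂ (s , eq) = contradiction (begin
          2                                                   ≤⟨ ha ⟩
          occ a p                                             ≤⟨ occ-++-≤ a p s ⟩
          occ a (p ++ s)                                      ≡⟨ cong (occ a) (sym eq) ⟩
          occ a (events (lo b))                               ≡⟨ occ-events a (lo b) ⟩
          reached (lo a) (lo b) + reached (hi a) (lo b)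
            ≡⟨ cong (reached (lo a) (lo b) +_) (reached-no (<⇒≱ lb<ha)) ⟩
          reached (lo a) (lo b) + 0                           ≡⟨ +-identityʳ _ ⟩
          reached (lo a) (lo b)                               ≤⟨ reached≤1 _ _ ⟩
          1                                                   ∎) λ { (s≤s ()) }
        to : Precedes (events S) a 2 b 1 → hi a < lo b
        to prec with hi a <? lo b
        ... | yes ha<lb = ha<lb
        ... | no  ha≮lb = contradiction prec (not-before (≤∧≢⇒< (≮⇒≥ ha≮lb) (disjoint a b)))

-- Replaces the rational endpoints by natural ones with the same order
-- between right and left endpoints: a value is ranked by the number of
-- right endpoints strictly below it; left endpoints become odd, right
-- endpoints even, so that no left endpoint equals a right one.
module Discretization {n} (J : IntervalRep n) where

  lo hi : Fin n → ℚ
  lo = proj₁ J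
  hi = proj₁ (proj₂ J)

  rank : ℚ → ℕ
  rank v = length (filter (λ c → hi c ℚ.<? v) (allFin n))

  rank-mono : ∀ {v v′} → v ℚ.≤ v′ → rank v ≤ rank v′
  rank-mono v≤v′ = length-filter-mono _ _ (λ lt → QP.<-≤-trans lt v≤v′) (allFin n)

  rank-mono-< : ∀ {x v} → hi x ℚ.< v → rank (hi x) < rank v
  rank-mono-< {x} hx<v = length-filter-mono-< _ _ (λ lt → QP.<-trans lt hx<v)
    (allFin n) (∈-allFin x) (QP.<-irrefl refl) hx<v

  loℕ hiℕ : Fin n → ℕ
  loℕ a = suc (2 * rank (lo a))
  hiℕ a = 2 + 2 * rank (hi a)

  loℕ-positive : ∀ a → 1 ≤ loℕ a
  loℕ-positive a = s≤s z≤n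

  loℕ≤hiℕ : ∀ a → loℕ a ≤ hiℕ a
  loℕ≤hiℕ a = s≤s (m≤n⇒m≤1+n (*-monoʳ-≤ 2 (rank-mono (proj₂ (proj₂ J) a))))

  loℕ≢hiℕ : ∀ a b → loℕ b ≢ hiℕ a
  loℕ≢hiℕ a b e = even≢odd (suc (rank (hi a))) (rank (lo b)) (trans (*-suc 2 _) (sym e))

  hiℕ-bounded : ∀ a → hiℕ a ≤ 2 + 2 * length (allFin n)
  hiℕ-bounded a = s≤s (s≤s (*-monoʳ-≤ 2 (length-filter _ (allFin n))))

  hiℕ<loℕ⇔ : ∀ a b → hiℕ a < loℕ b ⇔ IntervalPrec J a b
  hiℕ<loℕ⇔ a b = mk⇔ to from
    where
    to : hiℕ a < loℕ b → hi a ℚ.< lo b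
    to lt with hi a ℚ.<? lo b
    ... | yes ha<lb = ha<lb
    ... | no  ha≮lb = contradiction lt
      (≤⇒≯ (≤-trans (s≤s (*-monoʳ-≤ 2 (rank-mono (QP.≮⇒≥ ha≮lb)))) (n≤1+n _)))
    from : hi a ℚ.< lo b → hiℕ a < loℕ b
    from ha<lb = s≤s (subst (_≤ 2 * rank (lo b)) (*-suc 2 (rank (hi a))) (*-monoʳ-≤ 2 (rank-mono-< ha<lb)))

intervalWord : ∀ {n} → IntervalRep n → List (Fin n)
intervalWord {n} J = events (2 + 2 * length (allFin n))
  where open Discretization J
        open EventWord loℕ hiℕ

module _ {n} (J : IntervalRep n) where
  open Discretization J
  open EventWord loℕ hiℕ

  occ-intervalWord : ∀ a → occ a (intervalWord J) ≡ 2
  occ-intervalWord = occ-events-S loℕ-positive loℕ≤hiℕ (2 + 2 * length (allFin n)) hiℕ-bounded loℕ≢hiℕ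

  Precedes-intervalWord⇔ : ∀ a b → Precedes (intervalWord J) a 2 b 1 ⇔ IntervalPrec J a b
  Precedes-intervalWord⇔ a b = Composition.equivalence
    (Precedes-events⇔ loℕ-positive loℕ≤hiℕ (2 + 2 * length (allFin n)) hiℕ-bounded loℕ≢hiℕ a b)
    (hiℕ<loℕ⇔ a b)

clamp : ∀ {m d} → Fin d → Fin (suc m)
clamp {m} k with toℕ k <? suc m
... | yes k≤m = fromℕ< k≤m
... | no  _   = Fin.zero

clamp-inject≤ : ∀ {m d} (i : Fin (suc m)) (m<d : suc m ≤ d) → clamp (Fin.inject≤ i m<d) ≡ i
clamp-inject≤ {m} i m<d with toℕ (Fin.inject≤ i m<d) <? suc m
... | yes i≤m = FinP.toℕ-injective (trans (FinP.toℕ-fromℕ< i≤m) (FinP.toℕ-inject≤ i m<d))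
... | no  i≰m = contradiction (subst (_< suc m) (sym (FinP.toℕ-inject≤ i m<d)) (FinP.toℕ<n i)) i≰m

-- Repeating one of the interval orders does not change the intersection;
-- with no interval order at all, irreflexivity forces the poset to be empty.
IntervalDimAtMost⇒IsIntersectionOfIntervalOrders : ∀ {n d} {_≺_ : Fin n → Fin n → Set} →
  IsStrictPartialOrder _≡_ _≺_ → IntervalDimAtMost d _≺_ → IsIntersectionOfIntervalOrders d _≺_
IntervalDimAtMost⇒IsIntersectionOfIntervalOrders {n} spo (zero , _ , I , ≺⇔) =
  (λ _ → (λ x → ⊥-elim (empty x)) , (λ x → ⊥-elim (empty x)) , (λ x → ⊥-elim (empty x))) ,
  (λ x _ → ⊥-elim (empty x))
  where
  empty : Fin n → ⊥
  empty x = IsStrictPartialOrder.irrefl spo refl (Equivalence.from (≺⇔ x x) λ ())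
IntervalDimAtMost⇒IsIntersectionOfIntervalOrders spo (suc m , m<d , I , ≺⇔) =
  I ∘ clamp , λ x y → mk⇔
    (λ x≺y k → Equivalence.to (≺⇔ x y) x≺y (clamp k))
    (λ prec → Equivalence.from (≺⇔ x y) λ i →
      subst (λ j → IntervalPrec (I j) x y) (clamp-inject≤ i m<d) (prec (Fin.inject≤ i m<d)))

IsCompGraphIdimAtMost⇒InGraphClass : ∀ d → 1 ≤ d → ∀ {n} (E : Fin n → Fin n → Set) →
  IsCompGraphIdimAtMost d E → InGraphClass (Lidim d) E
IsCompGraphIdimAtMost⇒InGraphClass d 1≤d {n} E (_≺_ , ≺-spo , ≺-dim , comparability) =
  n , W , uses-all , id , Identity.bijective _≡_ , E⇔
  where
  I : Fin d → IntervalRep n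
  I = proj₁ (IntervalDimAtMost⇒IsIntersectionOfIntervalOrders ≺-spo ≺-dim)
  ≺⇔ : ∀ x y → x ≺ y ⇔ (∀ i → IntervalPrec (I i) x y)
  ≺⇔ = proj₂ (IntervalDimAtMost⇒IsIntersectionOfIntervalOrders ≺-spo ≺-dim)
  W : List (Fin n)
  W = concat (tabulate (intervalWord ∘ I))
  occ-W : ∀ a → occ a W ≡ 2 * d
  occ-W a = occ-concat (intervalWord ∘ I) a (λ i → occ-intervalWord (I i) a)
  uses-all : UsesAllLetters W
  uses-all a = occ⇒∈ a W (subst (1 ≤_) (sym (occ-W a)) (≤-trans 1≤d (m≤m+n d _)))
  Separated⇔≺ : ∀ a b → Separated d W a b ⇔ a ≺ b
  Separated⇔≺ a b = Composition.equivalence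
    (mk⇔ (λ s i → Equivalence.to (round⇔ i) (s i)) (λ s i → Equivalence.from (round⇔ i) (s i)))
    (⇔-sym (≺⇔ a b))
    where
    round⇔ : ∀ i → Precedes W a (2 + 2 * toℕ i) b (suc (2 * toℕ i)) ⇔ IntervalPrec (I i) a b
    round⇔ i = Composition.equivalence
      (Precedes-concat⇔ (intervalWord ∘ I)
        (λ j → occ-intervalWord (I j) a) (λ j → occ-intervalWord (I j) b) i)
      (Precedes-intervalWord⇔ (I i) a b)
  E⇔ : ∀ u v → E u v ⇔ GAdj (Lidim d) W u v
  E⇔ u v = Composition.equivalence (comparability u v) (mk⇔ to from)
    where
    Lidim⇔≺ : u ≢ v → Lidim d (hom u v W) ⇔ (u ≺ v ⊎ v ≺ u)
    Lidim⇔≺ u≢v = Composition.equivalence (Lidim-hom⇔ d W u≢v (occ-W u) (occ-W v))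
                                          (Separated⇔≺ u v ⊎-⇔ Separated⇔≺ v u)
    to : u ≢ v × (u ≺ v ⊎ v ≺ u) → GAdj (Lidim d) W u v
    to (u≢v , h) = u≢v , Equivalence.from (Lidim⇔≺ u≢v) h
    from : GAdj (Lidim d) W u v → u ≢ v × (u ≺ v ⊎ v ≺ u)
    from (u≢v , l) = u≢v , Equivalence.to (Lidim⇔≺ u≢v) l

theorem19 : (d : ℕ) → 1 ≤ d →
    IsUniformLang (2 * d) (Lidim d) ×
    (∀ (n : ℕ) (E : Fin n → Fin n → Set) → IsSimpleGraph E →
      (InGraphClass (Lidim d) E ⇔ IsCompGraphIdimAtMost d E))
theorem19 d 1≤d =
  (λ _ → proj₁) ,
  λ n E _ → mk⇔ (InGraphClass⇒IsCompGraphIdimAtMost d 1≤d E) (IsCompGraphIdimAtMost⇒InGraphClass d 1≤d E)
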